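{- Let $\mathcal R=\langle R,<,+,\cdot\rangle$ be a real closed field and $\widetilde{\mathcal R}$ an expansion of $\mathcal R$. Let $X\subseteq R^n$ be an open semialgebraic set and let $Y\subseteq \overline{X}$ be a set definable in $\widetilde{\mathcal R}$ such that $\dim(X\setminus Y)<n$. Then $\overline{Y}=\overline{X}$.
   Context: Semialgebraic means definable in $\mathcal R$ with parameters; definable means definable in $\widetilde{\mathcal R}$ with parameters. Topology on $R^n$ is the product of the order topology; $\overline{S}$ denotes closure. For an arbitrary set $Z\subseteq R^n$, $\dim Z$ is the maximum $k$ such that some projection of $Z$ onto $k$ of the coordinates has non-empty interior in $R^k$. By an open set the paper always means a non-empty open set. -}

module Defs where

open import Data.Nat using (ℕ; zero; suc; _≤_; _%_)
import Data.Nat as ℕ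
open import Data.Fin using (Fin)
open import Data.List using (List; []; _∷_; length)
open import Data.Product using (Σ; ∃; _×_; _,_)
open import Data.Sum using (_⊎_)
open import Data.Empty using (⊥)
open import Relation.Nullary using (¬_)
open import Relation.Binary.PropositionalEquality using (_≡_)
open import Function.Definitions using (Injective)
open import Data.Vec.Functional using (Vector; _++_)

-- Horner evaluation of the MONIC polynomial
--   c₀ + c₁ x + … + c_{d-1} x^{d-1} + x^d     (d = length cs)

monicEval : {A : Set} → (A → A → A) → (A → A → A) → A → List A → A → A
monicEval _+_ _*_ one []       x = one
monicEval _+_ _*_ one (c ∷ cs) x = c + (x * monicEval _+_ _*_ one cs x)

record RealClosedField : Set₁ where
  infixl 6 _+_
  infixl 7 _*_
  infix  4 _<_
  field
    Carrier : Set
    0# 1#   : Carrier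
    _+_ _*_ : Carrier → Carrier → Carrier
    -_      : Carrier → Carrier
    _<_     : Carrier → Carrier → Set
    +-assoc     : ∀ x y z → (x + y) + z ≡ x + (y + z)
    +-comm      : ∀ x y → x + y ≡ y + x
    +-identityˡ : ∀ x → 0# + x ≡ x
    -‿inverseˡ  : ∀ x → (- x) + x ≡ 0#
    *-assoc     : ∀ x y z → (x * y) * z ≡ x * (y * z)
    *-comm      : ∀ x y → x * y ≡ y * x
    *-identityˡ : ∀ x → 1# * x ≡ x
    distribˡ    : ∀ x y z → x * (y + z) ≡ (x * y) + (x * z)
    0≢1     : ¬ (0# ≡ 1#)
    inverse : ∀ x → ¬ (x ≡ 0#) → ∃ λ y → x * y ≡ 1#
    <-irrefl     : ∀ x → ¬ (x < x)
    <-trans      : ∀ x y z → x < y → y < z → x < z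
    <-trichotomy : ∀ x y → x < y ⊎ (x ≡ y ⊎ y < x)
    +-mono-<     : ∀ x y z → x < y → x + z < y + z
    *-pos        : ∀ x y → 0# < x → 0# < y → 0# < x * y
    sqrt     : ∀ x → 0# < x → ∃ λ y → y * y ≡ x
    odd-root : ∀ (cs : List Carrier) → length cs % 2 ≡ 1 →
               ∃ λ x → monicEval _+_ _*_ 1# cs x ≡ 0#

-- First-order languages extending the language of ordered rings
-- ⟨<, +, ·⟩ (we also allow 0, 1, -, harmless) by relation symbols.

record Language : Set₁ where
  field
    Sym   : Set
    arity : Sym → ℕ

open Language public

ringLanguage : Language
ringLanguage = record { Sym = ⊥ ; arity = λ () }

data Term (m : ℕ) : Set where
  var      : Fin m → Term m
  zero′ one′ : Term m
  plus times : Term m → Term m → Term m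
  neg      : Term m → Term m

data Formula (L : Language) : ℕ → Set where
  lt eq  : ∀ {m} → Term m → Term m → Formula L m
  rel    : ∀ {m} (s : Sym L) → (Fin (arity L s) → Term m) → Formula L m
  not    : ∀ {m} → Formula L m → Formula L m
  and or : ∀ {m} → Formula L m → Formula L m → Formula L m
  ex all : ∀ {m} → Formula L (suc m) → Formula L m

record Expansion (F : RealClosedField) : Set₁ where
  field
    lang   : Language
    interp : (s : Sym lang) → (Fin (arity lang s) → RealClosedField.Carrier F) → Set

module _ (F : RealClosedField) where
  open RealClosedField F

  Pt : ℕ → Set
  Pt n = Fin n → Carrier

  evalT : ∀ {m} → Pt m → Term m → Carrier
  evalT ρ (var i)     = ρ i
  evalT ρ zero′       = 0#
  evalT ρ one′        = 1#
  evalT ρ (plus s t)  = evalT ρ s + evalT ρ t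
  evalT ρ (times s t) = evalT ρ s * evalT ρ t
  evalT ρ (neg t)     = - evalT ρ t

  cons : ∀ {m} → Carrier → Pt m → Pt (suc m)
  cons a ρ Fin.zero    = a
  cons a ρ (Fin.suc i) = ρ i

  Sat : (L : Language) → ((s : Sym L) → Pt (arity L s) → Set) →
        ∀ {m} → Formula L m → Pt m → Set
  Sat L I (lt s t)  ρ = evalT ρ s < evalT ρ t
  Sat L I (eq s t)  ρ = evalT ρ s ≡ evalT ρ t
  Sat L I (rel s a) ρ = I s (λ i → evalT ρ (a i))
  Sat L I (not φ)   ρ = ¬ Sat L I φ ρ
  Sat L I (and φ ψ) ρ = Sat L I φ ρ × Sat L I ψ ρ
  Sat L I (or φ ψ)  ρ = Sat L I φ ρ ⊎ Sat L I ψ ρ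
  Sat L I (ex φ)    ρ = ∃ λ a → Sat L I φ (cons a ρ)
  Sat L I (all φ)   ρ = ∀ a → Sat L I φ (cons a ρ)

  DefinableIn : (L : Language) → ((s : Sym L) → Pt (arity L s) → Set) →
                ∀ {n} → (Pt n → Set) → Set
  DefinableIn L I {n} S =
    Σ ℕ λ p → Σ (Formula L (n ℕ.+ p)) λ φ → Σ (Pt p) λ a →
      ∀ x → (S x → Sat L I φ (x ++ a)) × (Sat L I φ (x ++ a) → S x)

  Semialgebraic : ∀ {n} → (Pt n → Set) → Set
  Semialgebraic = DefinableIn ringLanguage (λ ())

  Definable : Expansion F → ∀ {n} → (Pt n → Set) → Set
  Definable E = DefinableIn (Expansion.lang E) (Expansion.interp E)

  -- topology: product of the order topology, via open boxes
  InBox : ∀ {n} → Pt n → Carrier → Pt n → Set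
  InBox x ε y = ∀ i → (x i + (- ε) < y i) × (y i < x i + ε)

  Closure : ∀ {n} → (Pt n → Set) → Pt n → Set
  Closure S x = ∀ ε → 0# < ε → ∃ λ y → S y × InBox x ε y

  -- open in the paper's sense: non-empty and open
  IsOpen : ∀ {n} → (Pt n → Set) → Set
  IsOpen X = (∃ λ x → X x) ×
             (∀ x → X x → ∃ λ ε → 0# < ε × (∀ y → InBox x ε y → X y))

  HasNonemptyInterior : ∀ {n} → (Pt n → Set) → Set
  HasNonemptyInterior Z = ∃ λ x → ∃ λ ε → 0# < ε × (∀ y → InBox x ε y → Z y)

  Projection : ∀ {n k} → (Fin k → Fin n) → (Pt n → Set) → Pt k → Set
  Projection σ Z y = ∃ λ x → Z x × (∀ i → y i ≡ x (σ i))

  -- dim Z < m : no projection of Z onto k ≥ m distinct coordinates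
  -- has non-empty interior (i.e. the maximum k in the definition of
  -- dim, if any, is < m; dim ∅ = -∞ < m)
  DimLessThan : ∀ {n} → (Pt n → Set) → ℕ → Set
  DimLessThan {n} Z m = ∀ k → m ≤ k → (σ : Fin k → Fin n) →
    Injective _≡_ _≡_ σ → ¬ HasNonemptyInterior (Projection σ Z)

  _⊆_ : ∀ {n} → (Pt n → Set) → (Pt n → Set) → Set
  S ⊆ T = ∀ x → S x → T x

  _∖_ : ∀ {n} → (Pt n → Set) → (Pt n → Set) → Pt n → Set
  (S ∖ T) x = S x × ¬ T x

  _≐_ : ∀ {n} → (Pt n → Set) → (Pt n → Set) → Set
  S ≐ T = S ⊆ T × T ⊆ S

ExcludedMiddle : Set₁
ExcludedMiddle = (P : Set) → P ⊎ ¬ P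

-- It rests on two facts.
--   * Closure is monotone and idempotent (cl (cl S) ⊆ cl S, by the
--     triangle inequality for boxes of half the radius).
--   * X ⊆ cl Y: a box around a point of X that lies inside X and misses
--     Y would be a box inside X ∖ Y, i.e. an interior point of X ∖ Y;
--     but a set with non-empty interior in Rⁿ has dimension n (project
--     onto all n coordinates), contradicting dim (X ∖ Y) < n.  Deciding
--     whether the box meets Y uses excluded middle.
-- Then cl Y ⊆ cl (cl X) ⊆ cl X and cl X ⊆ cl (cl Y) ⊆ cl Y.

module Submission where

open import Defs
open import Data.Nat using (ℕ)
open import Data.Nat.Properties using (≤-refl)
open import Data.Product using (∃; _×_; _,_; proj₁; proj₂)
open import Data.Sum using (inj₁; inj₂)
open import Data.Empty using (⊥-elim)
open import Relation.Nullary using (¬_)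
open import Relation.Binary.PropositionalEquality
  using (_≡_; refl; sym; trans; cong; cong₂; subst₂; isEquivalence; module ≡-Reasoning)
open import Algebra.Bundles using (CommutativeRing)
open import Algebra.Consequences.Propositional using (comm∧idˡ⇒id; comm∧invˡ⇒inv; comm∧distrˡ⇒distrʳ)
import Algebra.Properties.Ring as RingProperties

module OrderedField (F : RealClosedField) where
  open RealClosedField F
  open ≡-Reasoning

  -- The ring axioms of F packaged as a commutative ring, so that the
  -- derived ring laws can be taken from the library.
  commutativeRing : CommutativeRing _ _
  commutativeRing = record
    { Carrier = Carrier ; _≈_ = _≡_ ; _+_ = _+_ ; _*_ = _*_ ; -_ = -_
    ; 0# = 0# ; 1# = 1#
    ; isCommutativeRing = record
      { isRing = record
        { +-isAbelianGroup = record
          { isGroup = record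
            { isMonoid = record
              { isSemigroup = record
                { isMagma = record { isEquivalence = isEquivalence ; ∙-cong = cong₂ _+_ }
                ; assoc = +-assoc }
              ; identity = comm∧idˡ⇒id +-comm +-identityˡ }
            ; inverse = comm∧invˡ⇒inv +-comm -‿inverseˡ
            ; ⁻¹-cong = cong -_ }
          ; comm = +-comm }
        ; *-cong = cong₂ _*_
        ; *-assoc = *-assoc
        ; *-identity = comm∧idˡ⇒id *-comm *-identityˡ
        ; distrib = distribˡ , comm∧distrˡ⇒distrʳ *-comm distribˡ }
      ; *-comm = *-comm } }

  open CommutativeRing commutativeRing using (zeroʳ; *-identityʳ; -‿inverseʳ; ring)
  open RingProperties ring using (-‿involutive; -‿+-comm; -‿distribˡ-*; -‿distribʳ-*; -0#≈0#)

  <-asym : ∀ {x y} → x < y → ¬ (y < x)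
  <-asym {x} {y} x<y y<x = <-irrefl x (<-trans x y x x<y y<x)

  +-monoʳ-< : ∀ z {x y} → x < y → z + x < z + y
  +-monoʳ-< z {x} {y} x<y = subst₂ _<_ (+-comm x z) (+-comm y z) (+-mono-< x y z x<y)

  -- negation reverses the order: add -x-y to both sides of x < y
  neg-antitone : ∀ {x y} → x < y → - y < - x
  neg-antitone {x} {y} x<y =
    subst₂ _<_ (cancel x (- y)) (trans (cong (y +_) (+-comm (- x) (- y))) (cancel y (- x)))
      (+-mono-< x y ((- x) + (- y)) x<y)
    where
    cancel : ∀ a b → a + ((- a) + b) ≡ b
    cancel a b = begin
      a + ((- a) + b) ≡⟨ sym (+-assoc a (- a) b) ⟩
      (a + (- a)) + b ≡⟨ cong (_+ b) (-‿inverseʳ a) ⟩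
      0# + b          ≡⟨ +-identityˡ b ⟩
      b               ∎

  neg-of-pos : ∀ {x} → 0# < x → - x < 0#
  neg-of-pos 0<x = subst₂ _<_ refl -0#≈0# (neg-antitone 0<x)

  neg-of-neg : ∀ {x} → x < 0# → 0# < - x
  neg-of-neg x<0 = subst₂ _<_ -0#≈0# refl (neg-antitone x<0)

  -- 1 is positive: otherwise -1 > 0 and 1 = (-1)(-1) > 0
  0<1 : 0# < 1#
  0<1 with <-trichotomy 0# 1#
  ... | inj₁ 0<1 = 0<1
  ... | inj₂ (inj₁ 0≡1) = ⊥-elim (0≢1 0≡1)
  ... | inj₂ (inj₂ 1<0) =
    ⊥-elim (<-asym 1<0 (subst₂ _<_ refl square (*-pos _ _ 0<-1 0<-1)))
    where
    0<-1 : 0# < - 1#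
    0<-1 = neg-of-neg 1<0
    square : (- 1#) * (- 1#) ≡ 1#
    square = begin
      (- 1#) * (- 1#) ≡⟨ sym (-‿distribˡ-* 1# (- 1#)) ⟩
      - (1# * (- 1#)) ≡⟨ cong -_ (*-identityˡ (- 1#)) ⟩
      - (- 1#)        ≡⟨ -‿involutive 1# ⟩
      1#              ∎

  inverse-pos : ∀ {a b} → 0# < a → a * b ≡ 1# → 0# < b
  inverse-pos {a} {b} 0<a ab≡1 with <-trichotomy 0# b
  ... | inj₁ 0<b = 0<b
  ... | inj₂ (inj₁ 0≡b) = ⊥-elim (0≢1 (begin
    0#     ≡⟨ sym (zeroʳ a) ⟩
    a * 0# ≡⟨ cong (a *_) 0≡b ⟩
    a * b  ≡⟨ ab≡1 ⟩
    1#     ∎))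
  ... | inj₂ (inj₂ b<0) =
    ⊥-elim (<-asym (neg-of-pos 0<1) (subst₂ _<_ refl a[-b]≡-1 (*-pos _ _ 0<a (neg-of-neg b<0))))
    where
    a[-b]≡-1 : a * (- b) ≡ - 1#
    a[-b]≡-1 = trans (sym (-‿distribʳ-* a b)) (cong -_ ab≡1)

  two : Carrier
  two = 1# + 1#

  0<two : 0# < two
  0<two = <-trans _ _ _ 0<1 (subst₂ _<_ (+-identityˡ 1#) refl (+-mono-< 0# 1# 1# 0<1))

  two≢0 : ¬ (two ≡ 0#)
  two≢0 two≡0 = <-irrefl 0# (subst₂ _<_ refl two≡0 0<two)

  half : Carrier → Carrier
  half ε = ε * proj₁ (inverse two two≢0)

  half-pos : ∀ {ε} → 0# < ε → 0# < half ε
  half-pos 0<ε = *-pos _ _ 0<ε (inverse-pos 0<two (proj₂ (inverse two two≢0)))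

  half+half : ∀ ε → half ε + half ε ≡ ε
  half+half ε = begin
    ε * i + ε * i        ≡⟨ sym (distribˡ ε i i) ⟩
    ε * (i + i)          ≡⟨ cong (λ t → ε * (t + t)) (sym (*-identityʳ i)) ⟩
    ε * (i * 1# + i * 1#) ≡⟨ cong (ε *_) (sym (distribˡ i 1# 1#)) ⟩
    ε * (i * two)        ≡⟨ cong (ε *_) (trans (*-comm i two) two*i≡1) ⟩
    ε * 1#               ≡⟨ *-identityʳ ε ⟩
    ε                    ∎
    where
    i = proj₁ (inverse two two≢0)
    two*i≡1 = proj₂ (inverse two two≢0)

  sub-halves : ∀ x ε → (x + (- half ε)) + (- half ε) ≡ x + (- ε)
  sub-halves x ε = begin
    (x + (- h)) + (- h) ≡⟨ +-assoc x (- h) (- h) ⟩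
    x + ((- h) + (- h)) ≡⟨ cong (x +_) (-‿+-comm h h) ⟩
    x + (- (h + h))     ≡⟨ cong (λ t → x + (- t)) (half+half ε) ⟩
    x + (- ε)           ∎
    where h = half ε

  add-halves : ∀ x ε → (x + half ε) + half ε ≡ x + ε
  add-halves x ε = trans (+-assoc x (half ε) (half ε)) (cong (x +_) (half+half ε))

module Topology (F : RealClosedField) where
  open RealClosedField F
  open OrderedField F

  box-mono : ∀ {n} (x : Pt F n) {a b} y → a < b → InBox F x a y → InBox F x b y
  box-mono x {a} {b} y a<b x∼y i =
    <-trans _ _ _ (+-monoʳ-< (x i) (neg-antitone a<b)) (proj₁ (x∼y i)) ,
    <-trans _ _ _ (proj₂ (x∼y i)) (+-monoʳ-< (x i) a<b)

  box-triangle : ∀ {n} (x y z : Pt F n) ε →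
    InBox F x (half ε) y → InBox F y (half ε) z → InBox F x ε z
  box-triangle x y z ε x∼y y∼z i =
    <-trans _ _ _ (subst₂ _<_ (sub-halves (x i) ε) refl (+-mono-< _ _ _ (proj₁ (x∼y i)))) (proj₁ (y∼z i)) ,
    <-trans _ _ _ (proj₂ (y∼z i)) (subst₂ _<_ refl (add-halves (x i) ε) (+-mono-< _ _ _ (proj₂ (x∼y i))))

  common-radius : ∀ {n} (x : Pt F n) δ η → 0# < δ → 0# < η →
    ∃ λ ρ → 0# < ρ × (∀ y → InBox F x ρ y → InBox F x δ y × InBox F x η y)
  common-radius x δ η 0<δ 0<η with <-trichotomy δ η
  ... | inj₁ δ<η = δ , 0<δ , λ y x∼y → x∼y , box-mono x y δ<η x∼y
  ... | inj₂ (inj₁ refl) = δ , 0<δ , λ y x∼y → x∼y , x∼y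
  ... | inj₂ (inj₂ η<δ) = η , 0<η , λ y x∼y → box-mono x y η<δ x∼y , x∼y

  closure-mono : ∀ {n} {S T : Pt F n → Set} → _⊆_ F S T → _⊆_ F (Closure F S) (Closure F T)
  closure-mono S⊆T x x∈clS ε 0<ε with x∈clS ε 0<ε
  ... | y , y∈S , x∼y = y , S⊆T y y∈S , x∼y

  -- cl (cl S) ⊆ cl S: approximate x by y ∈ cl S, then y by z ∈ S, each within ε/2
  closure-idempotent : ∀ {n} (S : Pt F n → Set) → _⊆_ F (Closure F (Closure F S)) (Closure F S)
  closure-idempotent S x x∈clclS ε 0<ε with x∈clclS (half ε) (half-pos 0<ε)
  ... | y , y∈clS , x∼y with y∈clS (half ε) (half-pos 0<ε)
  ... | z , z∈S , y∼z = z , z∈S , box-triangle x y z ε x∼y y∼z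

  -- a set with non-empty interior in Rⁿ has dimension n: its projection
  -- onto all n coordinates is the set itself
  interior⇒full-dimension : ∀ {n} (Z : Pt F n → Set) →
    HasNonemptyInterior F Z → ¬ DimLessThan F Z n
  interior⇒full-dimension {n} Z (x , ε , 0<ε , box⊆Z) dimZ<n =
    dimZ<n n ≤-refl (λ i → i) (λ i≡j → i≡j)
      (x , ε , 0<ε , λ y x∼y → y , box⊆Z y x∼y , λ i → refl)

  -- Y is dense in an open set X once X ∖ Y has empty interior: a box
  -- inside X around a point of X either meets Y or lies in X ∖ Y
  dense-in-open : ExcludedMiddle → ∀ {n} (X Y : Pt F n → Set) →
    (∀ x → X x → ∃ λ δ → 0# < δ × (∀ y → InBox F x δ y → X y)) →
    ¬ HasNonemptyInterior F (_∖_ F X Y) → _⊆_ F X (Closure F Y)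
  dense-in-open em X Y X-open X∖Y-thin x x∈X ε 0<ε with X-open x x∈X
  ... | δ , 0<δ , box⊆X with common-radius x δ ε 0<δ 0<ε
  ... | ρ , 0<ρ , shrink with em (∃ λ y → Y y × InBox F x ρ y)
  ... | inj₁ (y , y∈Y , x∼y) = y , y∈Y , proj₂ (shrink y x∼y)
  ... | inj₂ box∩Y=∅ = ⊥-elim (X∖Y-thin (x , ρ , 0<ρ , λ y x∼y →
          box⊆X y (proj₁ (shrink y x∼y)) , λ y∈Y → box∩Y=∅ (y , y∈Y , x∼y)))

lemma2p1 : ExcludedMiddle → (F : RealClosedField) → (E : Expansion F) →
    (n : ℕ) → (X Y : Pt F n → Set) →
    IsOpen F X → Semialgebraic F X → Definable F E Y →
    _⊆_ F Y (Closure F X) → DimLessThan F (_∖_ F X Y) n →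
    _≐_ F (Closure F Y) (Closure F X)
lemma2p1 em F E n X Y (_ , X-open) _ _ Y⊆clX dim[X∖Y]<n = clY⊆clX , clX⊆clY
  where
  open Topology F

  X⊆clY : _⊆_ F X (Closure F Y)
  X⊆clY = dense-in-open em X Y X-open (λ int → interior⇒full-dimension (_∖_ F X Y) int dim[X∖Y]<n)

  clY⊆clX : _⊆_ F (Closure F Y) (Closure F X)
  clY⊆clX x x∈clY = closure-idempotent X x (closure-mono Y⊆clX x x∈clY)

  clX⊆clY : _⊆_ F (Closure F X) (Closure F Y)
  clX⊆clY x x∈clX = closure-idempotent Y x (closure-mono X⊆clY x x∈clX)
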